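{- Let $s$ and $k\ge 4$ be positive integers and $n=2sk+1$. Then the circle graph $D$ on $n$ vertices determined by the set of odd integers $\{1,3,5,\ldots,2s-1\}$ has no diameter two subgraph on more than $2s+3$ vertices.
   Context: For an integer $n\ge 2$ and a set $S\subseteq\{1,\ldots,\lfloor n/2\rfloor\}$, the circle graph on $n$ vertices determined by $S$ is the graph with vertex set $\{0,1,\ldots,n-1\}$ in which two vertices $x,y$ are adjacent if and only if $(x-y)\bmod n\in S$ or $(y-x)\bmod n\in S$. A diameter two subgraph of a graph $G$ is a subgraph $H$ of $G$ such that for every pair of vertices $x,y$ of $H$ there is a path in $H$ joining $x$ and $y$ with at most two edges. -}

module Defs where

open import Data.Nat using (ℕ; zero; suc; _+_; _*_; _∸_; _<_; _≤_; NonZero)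
open import Data.Nat.DivMod using (_%_)
open import Data.Fin using (Fin; toℕ)
open import Data.Fin.Subset using (Subset; _∈_; ∣_∣)
open import Data.Product using (Σ; ∃; ∃-syntax; _×_)
open import Data.Sum using (_⊎_)
open import Relation.Binary.PropositionalEquality using (_≡_)

diffMod : (n : ℕ) .{{_ : NonZero n}} → Fin n → Fin n → ℕ
diffMod n x y = (toℕ x + n ∸ toℕ y) % n

CircleAdj : (n : ℕ) .{{_ : NonZero n}} → (ℕ → Set) → Fin n → Fin n → Set
CircleAdj n S x y = S (diffMod n x y) ⊎ S (diffMod n y x)

OddUpTo : ℕ → ℕ → Set
OddUpTo s d = ∃[ i ] (i < s × d ≡ 2 * i + 1)

record Subgraph (n : ℕ) (Adj : Fin n → Fin n → Set) : Set₁ where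
  field
    V     : Subset n
    E     : Fin n → Fin n → Set
    E-sym : ∀ x y → E x y → E y x
    E-sub : ∀ x y → E x y → (x ∈ V × y ∈ V × Adj x y)

DiameterTwo : {n : ℕ} {Adj : Fin n → Fin n → Set} → Subgraph n Adj → Set
DiameterTwo {n} H = ∀ (x y : Fin n) → x ∈ V → y ∈ V →
    (x ≡ y) ⊎ E x y ⊎ (∃[ z ] (z ∈ V × E x z × E z y))
  where open Subgraph H

order : {n : ℕ} {Adj : Fin n → Fin n → Set} → Subgraph n Adj → ℕ
order H = ∣ Subgraph.V H ∣

-- Fix a vertex x of H and write P = 2s + 1. Every vertex y of H is joined to x by a walk of
-- length at most two, so y - x ≡ d (mod n) for a displacement d that is either one odd step
-- (|d| < 2s) or a sum of two odd steps (d even, |d| ≤ 4s - 2). Reducing d modulo P is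
-- injective on H. If the displacements of y and z agree modulo P, their difference q is a
-- multiple of P with |q| ≤ 2P: the multiple 3P is odd, so one of the two displacements would
-- be a single step, and then |q| < 3P. But q ≡ z - y (mod n) is also congruent to a
-- displacement r, and since n > 8s this forces q = r; as no nonzero multiple of P is a
-- displacement, q = 0 and y = z. Hence H has at most P vertices.
module Submission where

open import Defs

-- Counting subsets by injections

module _ where
  open import Data.Fin.Base using (Fin; zero; suc)
  open import Data.Fin.Properties using (suc-injective; 0≢1+n)
  open import Data.Fin.Subset using (Subset; _∈_; ∣_∣; _-_; inside; outside)
  open import Data.Fin.Subset.Properties
    using (∣⊥∣≡0; nonempty?; Empty-unique; x∈p∧x≢y⇒x∈p-y; x∈p⇒∣p-x∣<∣p∣)
  open import Data.Nat.Base as ℕ using (z≤n; s≤s)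
  import Data.Nat.Properties as ℕ
  open import Data.Product using (_,_)
  open import Data.Vec.Base using (_∷_; []; here; there)
  open import Relation.Binary.PropositionalEquality using (_≡_; sym)
  open import Relation.Nullary using (yes; no)

  injection⇒∣p∣≤∣q∣ : ∀ {n m} (p : Subset n) (q : Subset m) (f : ∀ i → i ∈ p → Fin m) →
    (∀ i (i∈p : i ∈ p) → f i i∈p ∈ q) →
    (∀ {i j} (i∈p : i ∈ p) (j∈p : j ∈ p) → f i i∈p ≡ f j j∈p → i ≡ j) →
    ∣ p ∣ ℕ.≤ ∣ q ∣
  injection⇒∣p∣≤∣q∣ [] q f f∈q f-inj = z≤n
  injection⇒∣p∣≤∣q∣ (outside ∷ p) q f f∈q f-inj =
    injection⇒∣p∣≤∣q∣ p q (λ i i∈p → f (suc i) (there i∈p)) (λ i i∈p → f∈q (suc i) (there i∈p))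
      (λ i∈p j∈p eq → suc-injective (f-inj (there i∈p) (there j∈p) eq))
  injection⇒∣p∣≤∣q∣ (inside ∷ p) q f f∈q f-inj =
    ℕ.<-≤-trans (s≤s ∣p∣≤∣q-f₀∣) (x∈p⇒∣p-x∣<∣p∣ (f∈q zero here))
    where
    ∣p∣≤∣q-f₀∣ : ∣ p ∣ ℕ.≤ ∣ q - f zero here ∣
    ∣p∣≤∣q-f₀∣ = injection⇒∣p∣≤∣q∣ p (q - f zero here) (λ i i∈p → f (suc i) (there i∈p))
      (λ i i∈p → x∈p∧x≢y⇒x∈p-y (f∈q (suc i) (there i∈p))
                   λ eq → 0≢1+n (sym (f-inj (there i∈p) here eq)))
      (λ i∈p j∈p eq → suc-injective (f-inj (there i∈p) (there j∈p) eq))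

  ∣p∣≤-by-member : ∀ {n m} (p : Subset n) → (∀ {x} → x ∈ p → ∣ p ∣ ℕ.≤ m) → ∣ p ∣ ℕ.≤ m
  ∣p∣≤-by-member {n} p bound with nonempty? p
  ... | yes (_ , x∈p) = bound x∈p
  ... | no empty rewrite Empty-unique empty | ∣⊥∣≡0 n = z≤n

-- Congruences of integers

module _ where
  open import Data.Empty using (⊥-elim)
  open import Data.Fin.Base using (Fin; toℕ; fromℕ<)
  open import Data.Fin.Properties using (toℕ<n; toℕ-injective; fromℕ<-injective)
  open import Data.Fin.Subset using (_∈_; ⊤)
  open import Data.Fin.Subset.Properties using (∈⊤; ∣⊤∣≡n)
  open import Data.Integer.Base using (ℤ; +_; -_; _+_; _-_; _*_; ∣_∣; 0ℤ; 1ℤ; _%ℕ_; _/ℕ_)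
  import Data.Integer.Properties as ℤ
  open import Data.Integer.Divisibility.Signed
    using (_∣_; divides; ∣ᵤ⇒∣; ∣⇒∣ᵤ; ∣m∣n⇒∣m+n; ∣m∣n⇒∣m-n; ∣m⇒∣-m)
  open import Data.Integer.DivMod using (n%ℕd<d; a≡a%ℕn+[a/ℕn]*n)
  open import Data.Integer.Tactic.RingSolver using (solve-∀)
  open import Data.Nat.Base as ℕ using (ℕ; zero; suc; NonZero; z≤n; s≤s)
  import Data.Nat.Properties as ℕ
  import Data.Nat.Divisibility as ℕ
  import Data.Nat.Tactic.RingSolver as ℕ-Solver
  open import Data.Nat.DivMod using (_%_; _/_)
  open import Data.Product using (∃-syntax; _×_; _,_; proj₁; proj₂)
  open import Data.Sum using (_⊎_; inj₁; inj₂; [_,_]′)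
  open import Relation.Binary.PropositionalEquality
    using (_≡_; _≢_; refl; sym; trans; cong; cong₂; subst; module ≡-Reasoning)
  open import Relation.Nullary using (¬_)

  variable
    a b c d d′ q r : ℤ
    n s : ℕ

  -- A record rather than an abbreviation of + n ∣ a - b, so that a, b and n are inferable.
  infix 4 _≡_mod_
  record _≡_mod_ (a b : ℤ) (n : ℕ) : Set where
    constructor congruent
    field
      divides-difference : + n ∣ a - b
  open _≡_mod_

  ≡⇒≡-mod : a ≡ b → a ≡ b mod n
  ≡⇒≡-mod {a = a} refl = congruent (divides 0ℤ (ℤ.+-inverseʳ a))

  ≡-mod-sym : a ≡ b mod n → b ≡ a mod n
  ≡-mod-sym {a = a} {b = b} (congruent n∣a-b) =
    congruent (subst (_ ∣_) (negate-difference a b) (∣m⇒∣-m n∣a-b))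
    where
    negate-difference : ∀ a b → - (a - b) ≡ b - a
    negate-difference = solve-∀

  ≡-mod-trans : a ≡ b mod n → b ≡ c mod n → a ≡ c mod n
  ≡-mod-trans {a = a} {b = b} {c = c} (congruent n∣a-b) (congruent n∣b-c) =
    congruent (subst (_ ∣_) (telescope a b c) (∣m∣n⇒∣m+n n∣a-b n∣b-c))
    where
    telescope : ∀ a b c → (a - b) + (b - c) ≡ a - c
    telescope = solve-∀

  ≡-mod-+ : a ≡ b mod n → c ≡ d mod n → a + c ≡ b + d mod n
  ≡-mod-+ {a = a} {b = b} {c = c} {d = d} (congruent n∣a-b) (congruent n∣c-d) =
    congruent (subst (_ ∣_) (regroup a b c d) (∣m∣n⇒∣m+n n∣a-b n∣c-d))
    where
    regroup : ∀ a b c d → (a - b) + (c - d) ≡ (a + c) - (b + d)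
    regroup = solve-∀

  ≡-mod-neg : a ≡ b mod n → - a ≡ - b mod n
  ≡-mod-neg {a = a} {b = b} (congruent n∣a-b) =
    congruent (subst (_ ∣_) (regroup a b) (∣m⇒∣-m n∣a-b))
    where
    regroup : ∀ a b → - (a - b) ≡ - a - - b
    regroup = solve-∀

  ≡-mod-∣ : a ≡ b mod n → + n ∣ b → + n ∣ a
  ≡-mod-∣ {a = a} {b = b} (congruent n∣a-b) n∣b = subst (_ ∣_) (cancel a b) (∣m∣n⇒∣m+n n∣a-b n∣b)
    where
    cancel : ∀ a b → (a - b) + b ≡ a
    cancel = solve-∀

  n∣m<n⇒m≡0 : ∀ {m} → n ℕ.∣ m → m ℕ.< n → m ≡ 0
  n∣m<n⇒m≡0 {m = zero} _ _ = refl
  n∣m<n⇒m≡0 {m = suc _} n∣m m<n = ⊥-elim (ℕ.<⇒≱ m<n (ℕ.∣⇒≤ n∣m))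

  ≡-mod∧close⇒≡ : a ≡ b mod n → ∣ a - b ∣ ℕ.< n → a ≡ b
  ≡-mod∧close⇒≡ {a = a} {b = b} (congruent n∣a-b) close =
    ℤ.i-j≡0⇒i≡j a b (ℤ.∣i∣≡0⇒i≡0 (n∣m<n⇒m≡0 (∣⇒∣ᵤ n∣a-b) close))

  %ℕ-≡⇒≡-mod : ∀ a b .{{_ : NonZero n}} → a %ℕ n ≡ b %ℕ n → a ≡ b mod n
  %ℕ-≡⇒≡-mod {n = n} a b eq = congruent (divides (a /ℕ n - b /ℕ n) (begin
    a - b
      ≡⟨ cong₂ _-_ (a≡a%ℕn+[a/ℕn]*n a n) (a≡a%ℕn+[a/ℕn]*n b n) ⟩
    (+ (a %ℕ n) + a /ℕ n * + n) - (+ (b %ℕ n) + b /ℕ n * + n)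
      ≡⟨ cong (λ r → (+ r + a /ℕ n * + n) - (+ (b %ℕ n) + b /ℕ n * + n)) eq ⟩
    (+ (b %ℕ n) + a /ℕ n * + n) - (+ (b %ℕ n) + b /ℕ n * + n)
      ≡⟨ cancel (+ (b %ℕ n)) (a /ℕ n) (b /ℕ n) (+ n) ⟩
    (a /ℕ n - b /ℕ n) * + n ∎))
    where
    open ≡-Reasoning
    cancel : ∀ r p q n → (r + p * n) - (r + q * n) ≡ (p - q) * n
    cancel = solve-∀

  i≡∣i∣-mod-2 : ∀ i → i ≡ + ∣ i ∣ mod 2
  i≡∣i∣-mod-2 i with ℤ.+∣i∣≡i⊎+∣i∣≡-i i
  ... | inj₁ ∣i∣≡i = ≡⇒≡-mod (sym ∣i∣≡i)
  ... | inj₂ ∣i∣≡-i = congruent (divides i (trans (cong (_-_ i) ∣i∣≡-i) (double i)))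
    where
    double : ∀ i → i - - i ≡ i * + 2
    double = solve-∀

  ¬2∣2m+1 : ∀ m → ¬ 2 ℕ.∣ 2 ℕ.* m ℕ.+ 1
  ¬2∣2m+1 m 2∣2m+1 with ℕ.∣1⇒≡1 (ℕ.∣m+n∣m⇒∣n 2∣2m+1 (ℕ.m∣m*n m))
  ... | ()

  offset : Fin n → Fin n → ℤ
  offset y x = + toℕ y - + toℕ x

  offset-trans : ∀ (x y z : Fin n) → offset z x ≡ offset y x + offset z y
  offset-trans x y z = telescope (+ toℕ x) (+ toℕ y) (+ toℕ z)
    where
    telescope : ∀ x y z → z - x ≡ (y - x) + (z - y)
    telescope = solve-∀

  offset-difference : ∀ (x y z : Fin n) → offset z y ≡ offset z x - offset y x
  offset-difference x y z = cancel (+ toℕ x) (+ toℕ y) (+ toℕ z)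
    where
    cancel : ∀ x y z → z - y ≡ (z - x) - (y - x)
    cancel = solve-∀

  offset-sym : ∀ (x y : Fin n) → offset y x ≡ - offset x y
  offset-sym x y = swap (+ toℕ x) (+ toℕ y)
    where
    swap : ∀ x y → y - x ≡ - (x - y)
    swap = solve-∀

  offset≡diffMod : ∀ .{{_ : NonZero n}} (x y : Fin n) → offset y x ≡ + diffMod n y x mod n
  offset≡diffMod {n} x y = congruent (divides (+ (w / n) - 1ℤ) (begin
    (Y - X) - + (w % n)
      ≡⟨ regroup Y X (+ (w % n)) (+ (w / n)) (+ n) ⟩
    ((Y + + n) - X - (+ (w % n) + + (w / n) * + n)) + (+ (w / n) - 1ℤ) * + n
      ≡⟨ cong₂ (λ u v → (u - X - v) + (+ (w / n) - 1ℤ) * + n)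
               (cong +_ (sym w+x≡y+n)) (sym (a≡a%ℕn+[a/ℕn]*n (+ w) n)) ⟩
    ((+ w + X) - X - + w) + (+ (w / n) - 1ℤ) * + n
      ≡⟨ cancel (+ w) X ((+ (w / n) - 1ℤ) * + n) ⟩
    (+ (w / n) - 1ℤ) * + n ∎))
    where
    open ≡-Reasoning
    X Y : ℤ
    X = + toℕ x
    Y = + toℕ y
    w : ℕ
    w = toℕ y ℕ.+ n ℕ.∸ toℕ x
    w+x≡y+n : w ℕ.+ toℕ x ≡ toℕ y ℕ.+ n
    w+x≡y+n = ℕ.m∸n+n≡m (ℕ.≤-trans (ℕ.<⇒≤ (toℕ<n x)) (ℕ.m≤n+m n (toℕ y)))
    regroup : ∀ Y X R Q N → (Y - X) - R ≡ ((Y + N) - X - (R + Q * N)) + (Q - 1ℤ) * N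
    regroup = solve-∀
    cancel : ∀ W X M → ((W + X) - X - W) + M ≡ M
    cancel = solve-∀

  offset-injective : ∀ (x y z : Fin n) → offset y x ≡ offset z x mod n → y ≡ z
  offset-injective {n} x y z yx≡zx =
    toℕ-injective (ℤ.+-injective
      (≡-mod∧close⇒≡ y≡z (ℕ.≤-<-trans ∣y-z∣≤y⊔z (ℕ.⊔-lub (toℕ<n y) (toℕ<n z)))))
    where
    cancel : ∀ Y Z X → (Y - X) - (Z - X) ≡ Y - Z
    cancel = solve-∀
    y≡z : + toℕ y ≡ + toℕ z mod n
    y≡z = congruent
      (subst (+ n ∣_) (cancel (+ toℕ y) (+ toℕ z) (+ toℕ x)) (divides-difference yx≡zx))
    ∣y-z∣≤y⊔z : ∣ + toℕ y - + toℕ z ∣ ℕ.≤ toℕ y ℕ.⊔ toℕ z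
    ∣y-z∣≤y⊔z = subst (ℕ._≤ toℕ y ℕ.⊔ toℕ z) (cong ∣_∣ (sym (ℤ.m-n≡m⊖n (toℕ y) (toℕ z))))
                      (ℤ.∣m⊝n∣≤m⊔n (toℕ y) (toℕ z))

  -- Displacements of walks of length one or two

  oddUpTo-< : ∀ {m} → OddUpTo s m → m ℕ.< 2 ℕ.* s
  oddUpTo-< {s} (i , i<s , refl) = subst (ℕ._≤ 2 ℕ.* s) (double-suc i) (ℕ.*-monoʳ-≤ 2 i<s)
    where
    double-suc : ∀ i → 2 ℕ.* suc i ≡ suc (2 ℕ.* i ℕ.+ 1)
    double-suc = ℕ-Solver.solve-∀

  data Reach (s : ℕ) : ℤ → Set where
    one-step  : OddUpTo s ∣ d ∣ → Reach s d
    two-steps : ∀ a b → OddUpTo s ∣ a ∣ → OddUpTo s ∣ b ∣ → Reach s (a + b)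

  two-steps-even : ∀ a b → OddUpTo s ∣ a ∣ → OddUpTo s ∣ b ∣ → + 2 ∣ a + b
  two-steps-even a b (i , _ , ∣a∣≡2i+1) (j , _ , ∣b∣≡2j+1) =
    ≡-mod-∣ (≡-mod-+ (i≡∣i∣-mod-2 a) (i≡∣i∣-mod-2 b)) (∣ᵤ⇒∣ ∣a∣+∣b∣-even)
    where
    odd+odd : ∀ i j → 2 ℕ.* i ℕ.+ 1 ℕ.+ (2 ℕ.* j ℕ.+ 1) ≡ suc (i ℕ.+ j) ℕ.* 2
    odd+odd = ℕ-Solver.solve-∀
    ∣a∣+∣b∣-even : 2 ℕ.∣ ∣ a ∣ ℕ.+ ∣ b ∣
    ∣a∣+∣b∣-even = ℕ.divides (suc (i ℕ.+ j)) (trans (cong₂ ℕ._+_ ∣a∣≡2i+1 ∣b∣≡2j+1) (odd+odd i j))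

  m<2s∧m′<2s⇒m+m′+2≤4s : ∀ {m m′} → m ℕ.< 2 ℕ.* s → m′ ℕ.< 2 ℕ.* s → m ℕ.+ m′ ℕ.+ 2 ℕ.≤ 4 ℕ.* s
  m<2s∧m′<2s⇒m+m′+2≤4s {s} {m} {m′} m<2s m′<2s = begin
    m ℕ.+ m′ ℕ.+ 2      ≡⟨ shift m m′ ⟩
    suc m ℕ.+ suc m′    ≤⟨ ℕ.+-mono-≤ m<2s m′<2s ⟩
    2 ℕ.* s ℕ.+ 2 ℕ.* s ≡⟨ double s ⟩
    4 ℕ.* s             ∎
    where
    open ℕ.≤-Reasoning
    shift : ∀ m m′ → m ℕ.+ m′ ℕ.+ 2 ≡ suc m ℕ.+ suc m′
    shift = ℕ-Solver.solve-∀
    double : ∀ s → 2 ℕ.* s ℕ.+ 2 ℕ.* s ≡ 4 ℕ.* s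
    double = ℕ-Solver.solve-∀

  ∣reach∣+2≤4s : Reach s d → ∣ d ∣ ℕ.+ 2 ℕ.≤ 4 ℕ.* s
  ∣reach∣+2≤4s {s} {d} (one-step d-odd) =
    subst (ℕ._≤ 4 ℕ.* s) (cong (ℕ._+ 2) (ℕ.+-identityʳ ∣ d ∣))
      (m<2s∧m′<2s⇒m+m′+2≤4s {s} (oddUpTo-< d-odd) (ℕ.≤-trans (s≤s z≤n) (oddUpTo-< d-odd)))
  ∣reach∣+2≤4s {s} (two-steps a b a-odd b-odd) =
    ℕ.≤-trans (ℕ.+-monoˡ-≤ 2 (ℤ.∣i+j∣≤∣i∣+∣j∣ a b))
              (m<2s∧m′<2s⇒m+m′+2≤4s {s} (oddUpTo-< a-odd) (oddUpTo-< b-odd))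

  reach-zero : 0 ℕ.< s → Reach s 0ℤ
  reach-zero 0<s = two-steps (+ 1) (- + 1) (0 , 0<s , refl) (0 , 0<s , refl)

  one-step-distance<3P : OddUpTo s ∣ d ∣ → Reach s d′ → ∣ d′ - d ∣ ℕ.< 3 ℕ.* suc (2 ℕ.* s)
  one-step-distance<3P {s} {d} {d′} d-odd r′ = begin-strict
    ∣ d′ - d ∣                    ≤⟨ ℤ.∣i-j∣≤∣i∣+∣j∣ d′ d ⟩
    ∣ d′ ∣ ℕ.+ ∣ d ∣              <⟨ ℕ.m<m+n _ (s≤s z≤n) ⟩
    ∣ d′ ∣ ℕ.+ ∣ d ∣ ℕ.+ 3        ≡⟨ shift ∣ d′ ∣ ∣ d ∣ ⟩
    ∣ d′ ∣ ℕ.+ 2 ℕ.+ suc ∣ d ∣    ≤⟨ ℕ.+-mono-≤ (∣reach∣+2≤4s r′) (oddUpTo-< d-odd) ⟩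
    4 ℕ.* s ℕ.+ 2 ℕ.* s           ≤⟨ ℕ.m≤m+n _ 3 ⟩
    4 ℕ.* s ℕ.+ 2 ℕ.* s ℕ.+ 3     ≡⟨ triple s ⟩
    3 ℕ.* suc (2 ℕ.* s)           ∎
    where
    open ℕ.≤-Reasoning
    shift : ∀ a b → a ℕ.+ b ℕ.+ 3 ≡ a ℕ.+ 2 ℕ.+ suc b
    shift = ℕ-Solver.solve-∀
    triple : ∀ s → 4 ℕ.* s ℕ.+ 2 ℕ.* s ℕ.+ 3 ≡ 3 ℕ.* suc (2 ℕ.* s)
    triple = ℕ-Solver.solve-∀

  reach-distance<4P : Reach s d → Reach s d′ → ∣ d′ - d ∣ ℕ.< 4 ℕ.* suc (2 ℕ.* s)
  reach-distance<4P {s} {d} {d′} r r′ = begin-strict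
    ∣ d′ - d ∣                    ≤⟨ ℤ.∣i-j∣≤∣i∣+∣j∣ d′ d ⟩
    ∣ d′ ∣ ℕ.+ ∣ d ∣              <⟨ ℕ.m<m+n _ (s≤s z≤n) ⟩
    ∣ d′ ∣ ℕ.+ ∣ d ∣ ℕ.+ 4        ≡⟨ shift ∣ d′ ∣ ∣ d ∣ ⟩
    ∣ d′ ∣ ℕ.+ 2 ℕ.+ (∣ d ∣ ℕ.+ 2) ≤⟨ ℕ.+-mono-≤ (∣reach∣+2≤4s r′) (∣reach∣+2≤4s r) ⟩
    4 ℕ.* s ℕ.+ 4 ℕ.* s           ≤⟨ ℕ.m≤m+n _ 4 ⟩
    4 ℕ.* s ℕ.+ 4 ℕ.* s ℕ.+ 4     ≡⟨ quadruple s ⟩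
    4 ℕ.* suc (2 ℕ.* s)           ∎
    where
    open ℕ.≤-Reasoning
    shift : ∀ a b → a ℕ.+ b ℕ.+ 4 ≡ a ℕ.+ 2 ℕ.+ (b ℕ.+ 2)
    shift = ℕ-Solver.solve-∀
    quadruple : ∀ s → 4 ℕ.* s ℕ.+ 4 ℕ.* s ℕ.+ 4 ≡ 4 ℕ.* suc (2 ℕ.* s)
    quadruple = ℕ-Solver.solve-∀

  reach-distance : Reach s d → Reach s d′ →
    ∣ d′ - d ∣ ℕ.< 3 ℕ.* suc (2 ℕ.* s) ⊎ (∣ d′ - d ∣ ℕ.< 4 ℕ.* suc (2 ℕ.* s) × 2 ℕ.∣ ∣ d′ - d ∣)
  reach-distance (one-step d-odd) r′ = inj₁ (one-step-distance<3P d-odd r′)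
  reach-distance {s} {d} {d′} r (one-step d′-odd) =
    inj₁ (subst (ℕ._< 3 ℕ.* suc (2 ℕ.* s)) (ℤ.∣i-j∣≡∣j-i∣ d d′) (one-step-distance<3P d′-odd r))
  reach-distance r@(two-steps a b a-odd b-odd) r′@(two-steps a′ b′ a′-odd b′-odd) =
    inj₂ (reach-distance<4P r r′ ,
          ∣⇒∣ᵤ (∣m∣n⇒∣m-n (two-steps-even a′ b′ a′-odd b′-odd) (two-steps-even a b a-odd b-odd)))

  multiple-of-P≤2P : ∀ {m} c → m ≡ c ℕ.* suc (2 ℕ.* s) →
    m ℕ.< 3 ℕ.* suc (2 ℕ.* s) ⊎ (m ℕ.< 4 ℕ.* suc (2 ℕ.* s) × 2 ℕ.∣ m) →
    m ℕ.≤ 2 ℕ.* suc (2 ℕ.* s)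
  multiple-of-P≤2P 0 refl _ = z≤n
  multiple-of-P≤2P {s} 1 refl _ = ℕ.*-monoˡ-≤ (suc (2 ℕ.* s)) {1} {2} (s≤s z≤n)
  multiple-of-P≤2P 2 refl _ = ℕ.≤-refl
  multiple-of-P≤2P 3 refl (inj₁ 3P<3P) = ⊥-elim (ℕ.<-irrefl refl 3P<3P)
  multiple-of-P≤2P {s} 3 refl (inj₂ (_ , 2∣3P)) =
    ⊥-elim (¬2∣2m+1 (3 ℕ.* s ℕ.+ 1) (subst (2 ℕ.∣_) (odd-triple s) 2∣3P))
    where
    odd-triple : ∀ s → 3 ℕ.* suc (2 ℕ.* s) ≡ 2 ℕ.* (3 ℕ.* s ℕ.+ 1) ℕ.+ 1
    odd-triple = ℕ-Solver.solve-∀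
  multiple-of-P≤2P {s} (suc (suc (suc (suc c)))) refl far =
    ⊥-elim (ℕ.<⇒≱ m<4P (ℕ.*-monoˡ-≤ P {4} {4 ℕ.+ c} (s≤s (s≤s (s≤s (s≤s z≤n))))))
    where
    P : ℕ
    P = suc (2 ℕ.* s)
    m<4P : suc (suc (suc (suc c))) ℕ.* P ℕ.< 4 ℕ.* P
    m<4P = [ (λ m<3P → ℕ.<-≤-trans m<3P (ℕ.*-monoˡ-≤ P {3} {4} (s≤s (s≤s (s≤s z≤n)))))
           , proj₁ ]′ far

  reach-gap : Reach s d → Reach s d′ → d′ ≡ d mod suc (2 ℕ.* s) → ∣ d′ - d ∣ ℕ.≤ 2 ℕ.* suc (2 ℕ.* s)
  reach-gap {s} r r′ (congruent P∣d′-d) with ∣⇒∣ᵤ P∣d′-d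
  ... | ℕ.divides c eq = multiple-of-P≤2P {s} c eq (reach-distance r r′)

  ∣reach∣≢P : Reach s d → ∣ d ∣ ≢ suc (2 ℕ.* s)
  ∣reach∣≢P {s} (one-step d-odd) eq =
    ℕ.<⇒≱ (oddUpTo-< d-odd) (subst (2 ℕ.* s ℕ.≤_) (sym eq) (ℕ.n≤1+n _))
  ∣reach∣≢P {s} (two-steps a b a-odd b-odd) eq =
    ¬2∣2m+1 s (subst (2 ℕ.∣_) (trans eq (ℕ.+-comm 1 (2 ℕ.* s)))
                     (∣⇒∣ᵤ (two-steps-even a b a-odd b-odd)))

  reach-multiple-of-P≡0 : Reach s r → + suc (2 ℕ.* s) ∣ r → r ≡ 0ℤ
  reach-multiple-of-P≡0 {s} {r} reach-r P∣r with ∣⇒∣ᵤ P∣r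
  ... | ℕ.divides 0 eq = ℤ.∣i∣≡0⇒i≡0 eq
  ... | ℕ.divides 1 eq = ⊥-elim (∣reach∣≢P reach-r (trans eq (ℕ.+-identityʳ _)))
  ... | ℕ.divides (suc (suc c)) eq = ⊥-elim (ℕ.<⇒≱ ∣r∣<4s 4s≤∣r∣)
    where
    ∣r∣<4s : ∣ r ∣ ℕ.< 4 ℕ.* s
    ∣r∣<4s = ℕ.<-≤-trans (ℕ.m<m+n _ (s≤s z≤n)) (∣reach∣+2≤4s reach-r)
    4s≤∣r∣ : 4 ℕ.* s ℕ.≤ ∣ r ∣
    4s≤∣r∣ = begin
      4 ℕ.* s                         ≤⟨ ℕ.m≤m+n _ 2 ⟩
      4 ℕ.* s ℕ.+ 2                   ≡⟨ double-odd s ⟩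
      2 ℕ.* suc (2 ℕ.* s)             ≤⟨ ℕ.*-monoˡ-≤ (suc (2 ℕ.* s)) {2} {2 ℕ.+ c} (s≤s (s≤s z≤n)) ⟩
      suc (suc c) ℕ.* suc (2 ℕ.* s)   ≡⟨ eq ⟨
      ∣ r ∣                           ∎
      where
      open ℕ.≤-Reasoning
      double-odd : ∀ s → 4 ℕ.* s ℕ.+ 2 ≡ 2 ℕ.* suc (2 ℕ.* s)
      double-odd = ℕ-Solver.solve-∀

  ∣q-r∣≤8s : ∣ q ∣ ℕ.≤ 2 ℕ.* suc (2 ℕ.* s) → Reach s r → ∣ q - r ∣ ℕ.≤ 8 ℕ.* s
  ∣q-r∣≤8s {q} {s} {r} ∣q∣≤2P reach-r = ℕ.+-cancelʳ-≤ 2 _ _ (begin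
    ∣ q - r ∣ ℕ.+ 2                       ≤⟨ ℕ.+-monoˡ-≤ 2 (ℤ.∣i-j∣≤∣i∣+∣j∣ q r) ⟩
    ∣ q ∣ ℕ.+ ∣ r ∣ ℕ.+ 2                 ≡⟨ ℕ.+-assoc ∣ q ∣ ∣ r ∣ 2 ⟩
    ∣ q ∣ ℕ.+ (∣ r ∣ ℕ.+ 2)               ≤⟨ ℕ.+-mono-≤ ∣q∣≤2P (∣reach∣+2≤4s reach-r) ⟩
    2 ℕ.* suc (2 ℕ.* s) ℕ.+ 4 ℕ.* s       ≡⟨ regroup s ⟩
    8 ℕ.* s ℕ.+ 2                         ∎)
    where
    open ℕ.≤-Reasoning
    regroup : ∀ s → 2 ℕ.* suc (2 ℕ.* s) ℕ.+ 4 ℕ.* s ≡ 8 ℕ.* s ℕ.+ 2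
    regroup = ℕ-Solver.solve-∀

  adjacent⇒step : ∀ .{{_ : NonZero n}} (x y : Fin n) → CircleAdj n (OddUpTo s) x y →
    ∃[ d ] (OddUpTo s ∣ d ∣ × offset y x ≡ d mod n)
  adjacent⇒step x y (inj₂ odd) = + diffMod _ y x , odd , offset≡diffMod x y
  adjacent⇒step {n} {s} x y (inj₁ odd) =
    - + diffMod n x y ,
    subst (OddUpTo s) (sym (ℤ.∣-i∣≡∣i∣ (+ diffMod n x y))) odd ,
    ≡-mod-trans (≡⇒≡-mod (offset-sym x y)) (≡-mod-neg (offset≡diffMod y x))

  -- Diameter-two subgraphs

  module _ .{{_ : NonZero n}} {s} (H : Subgraph n (CircleAdj n (OddUpTo s)))
           (s>0 : 0 ℕ.< s) (diameter-two : DiameterTwo H) where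
    open Subgraph H

    edge⇒step : ∀ {x y} → E x y → ∃[ d ] (OddUpTo s ∣ d ∣ × offset y x ≡ d mod n)
    edge⇒step {x} {y} xy = adjacent⇒step x y (proj₂ (proj₂ (E-sub x y xy)))

    reach : ∀ {x y} → x ∈ V → y ∈ V → ∃[ d ] (Reach s d × offset y x ≡ d mod n)
    reach {x} {y} x∈V y∈V with diameter-two x y x∈V y∈V
    ... | inj₁ refl = 0ℤ , reach-zero s>0 , ≡⇒≡-mod (ℤ.+-inverseʳ (+ toℕ x))
    ... | inj₂ (inj₁ xy) with edge⇒step xy
    ...   | d , d-odd , yx≡d = d , one-step d-odd , yx≡d
    reach {x} {y} x∈V y∈V | inj₂ (inj₂ (z , _ , xz , zy)) with edge⇒step xz | edge⇒step zy
    ... | a , a-odd , zx≡a | b , b-odd , yz≡b =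
      a + b , two-steps a b a-odd b-odd ,
      ≡-mod-trans (≡⇒≡-mod (offset-trans x z y)) (≡-mod-+ zx≡a yz≡b)

    module _ (8s<n : 8 ℕ.* s ℕ.< n) {x} (x∈V : x ∈ V) where

      same-class⇒≡ : ∀ {y z dy dz} → y ∈ V → z ∈ V → Reach s dy → Reach s dz →
        offset y x ≡ dy mod n → offset z x ≡ dz mod n → dz ≡ dy mod suc (2 ℕ.* s) → y ≡ z
      same-class⇒≡ {y} {z} {dy} {dz} y∈V z∈V ry rz yx≡dy zx≡dz same-class with reach y∈V z∈V
      ... | r , reach-r , zy≡r =
        offset-injective x y z
          (≡-mod-trans yx≡dy (≡-mod-trans (≡⇒≡-mod (sym dz≡dy)) (≡-mod-sym zx≡dz)))
        where
        zy≡dz-dy : offset z y ≡ dz - dy mod n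
        zy≡dz-dy = ≡-mod-trans (≡⇒≡-mod (offset-difference x y z)) (≡-mod-+ zx≡dz (≡-mod-neg yx≡dy))
        close : ∣ (dz - dy) - r ∣ ℕ.< n
        close = ℕ.≤-<-trans (∣q-r∣≤8s {q = dz - dy} (reach-gap ry rz same-class) reach-r) 8s<n
        dz-dy≡r : dz - dy ≡ r
        dz-dy≡r = ≡-mod∧close⇒≡ (≡-mod-trans (≡-mod-sym zy≡dz-dy) zy≡r) close
        dz≡dy : dz ≡ dy
        dz≡dy = ℤ.i-j≡0⇒i≡j dz dy (trans dz-dy≡r
          (reach-multiple-of-P≡0 reach-r (subst (_ ∣_) dz-dy≡r (divides-difference same-class))))

      residue : ∀ y → y ∈ V → Fin (suc (2 ℕ.* s))
      residue y y∈V = fromℕ< (n%ℕd<d (proj₁ (reach x∈V y∈V)) (suc (2 ℕ.* s)))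

      residue-injective : ∀ {y z} (y∈V : y ∈ V) (z∈V : z ∈ V) →
        residue y y∈V ≡ residue z z∈V → y ≡ z
      residue-injective y∈V z∈V eq =
        let dy , ry , yx≡dy = reach x∈V y∈V
            dz , rz , zx≡dz = reach x∈V z∈V
        in same-class⇒≡ y∈V z∈V ry rz yx≡dy zx≡dz
             (%ℕ-≡⇒≡-mod dz dy (sym (fromℕ<-injective _ _ _ _ eq)))

    order≤2s+1 : 8 ℕ.* s ℕ.< n → order H ℕ.≤ suc (2 ℕ.* s)
    order≤2s+1 8s<n = ∣p∣≤-by-member V λ x∈V →
      subst (order H ℕ.≤_) (∣⊤∣≡n _)
        (injection⇒∣p∣≤∣q∣ V ⊤ (residue 8s<n x∈V) (λ _ _ → ∈⊤) (residue-injective 8s<n x∈V))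

open import Data.Nat using (ℕ; suc; _*_; _≤_; _+_; _<_; z≤n; s≤s)
open import Data.Nat.Properties using (≤-trans; *-monoʳ-≤; +-monoʳ-≤; +-comm)
open import Data.Nat.Tactic.RingSolver using (solve-∀)
open import Relation.Binary.PropositionalEquality using (_≡_; subst)

lemma6 : (s k : ℕ) → 1 ≤ s → 4 ≤ k →
    (H : Subgraph (suc (2 * s * k)) (CircleAdj (suc (2 * s * k)) (OddUpTo s))) →
    DiameterTwo H → order H ≤ 2 * s + 3
lemma6 s k 1≤s 4≤k H diameter-two = ≤-trans (order≤2s+1 H 1≤s diameter-two 8s<n) 2s+1≤2s+3
  where
  eight : ∀ s → 2 * s * 4 ≡ 8 * s
  eight = solve-∀
  8s<n : 8 * s < suc (2 * s * k)
  8s<n = s≤s (subst (_≤ 2 * s * k) (eight s) (*-monoʳ-≤ (2 * s) 4≤k))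
  2s+1≤2s+3 : suc (2 * s) ≤ 2 * s + 3
  2s+1≤2s+3 = subst (_≤ 2 * s + 3) (+-comm (2 * s) 1) (+-monoʳ-≤ (2 * s) (s≤s z≤n))
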